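{- Let $M$ be a matroid on a finite set $X$ with family of independent sets $\mathcal{I}$, and let $P_M=\operatorname{conv}\{e_A : A\in\mathcal{I}\}\subseteq\mathbb{R}^X$ be its independence polytope (whose vertices are the $e_A$, $A\in\mathcal{I}$). Two distinct vertices $e_A$ and $e_B$ of $P_M$ form an edge of $P_M$ if and only if there is a unique way to write $e_A+e_B$ as the sum of two vertices of $P_M$, i.e., for all $C,D\in\mathcal{I}$, $e_A+e_B=e_C+e_D$ implies $\{A,B\}=\{C,D\}$.
   Context: For a finite set $X$, $\mathbb{R}^X$ denotes the real vector space with standard basis $\{e_x : x\in X\}$, and for $A\subseteq X$ the indicator vector is $e_A=\sum_{a\in A}e_a$. A matroid on $X$ is a nonempty family $\mathcal{I}$ of subsets of $X$ (the independent sets) with $\emptyset\in\mathcal{I}$, closed under taking subsets, and such that if $A,B\in\mathcal{I}$ with $|B|>|A|$ then there is $b\in B\setminus A$ with $A\cup\{b\}\in\mathcal{I}$.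
   Formalization: $P_M$ is taken in ℚ^X rather than $\mathbb{R}^X$: its points have rational coordinates and rational convex weights, and the linear functional exposing an edge has rational coefficients. -}

module Defs where

open import Data.Nat using (ℕ; zero; suc)
import Data.Nat as ℕ
open import Data.Bool using (Bool; true; false; if_then_else_)
open import Data.Fin using (Fin; zero; suc)
open import Data.Fin.Subset using (Subset; _∈_; _∉_; _⊆_; ⁅_⁆; _∪_; ∣_∣; ⊥)
open import Data.Vec using (lookup)
open import Data.Rational using (ℚ; 0ℚ; 1ℚ; _+_; _*_; _-_; _≤_)
open import Data.List using (List; []; _∷_)
open import Data.List.Relation.Unary.All using (All)
open import Data.Product using (Σ; ∃; ∃-syntax; _×_; _,_; proj₁; proj₂)
open import Relation.Binary.PropositionalEquality using (_≡_)

record Matroid (n : ℕ) : Set₁ where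
  field
    Indep      : Subset n → Set
    indep-∅    : Indep ⊥
    indep-⊆    : ∀ {A B} → A ⊆ B → Indep B → Indep A
    augment    : ∀ {A B} → Indep A → Indep B → ∣ A ∣ ℕ.< ∣ B ∣ →
                 ∃[ b ] (b ∈ B × b ∉ A × Indep (A ∪ ⁅ b ⁆))

Vecℚ : ℕ → Set
Vecℚ n = Fin n → ℚ

e : ∀ {n} → Subset n → Vecℚ n
e A i = if lookup A i then 1ℚ else 0ℚ

_+ᵛ_ : ∀ {n} → Vecℚ n → Vecℚ n → Vecℚ n
(u +ᵛ v) i = u i + v i

_·ᵛ_ : ∀ {n} → ℚ → Vecℚ n → Vecℚ n
(t ·ᵛ v) i = t * v i

Σᶠ : ∀ {n} → (Fin n → ℚ) → ℚ
Σᶠ {zero}  f = 0ℚ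
Σᶠ {suc n} f = f zero + Σᶠ (λ i → f (suc i))

⟨_,_⟩ : ∀ {n} → Vecℚ n → Vecℚ n → ℚ
⟨ u , v ⟩ = Σᶠ (λ i → u i * v i)

_≈ᵛ_ : ∀ {n} → Vecℚ n → Vecℚ n → Set
u ≈ᵛ v = ∀ i → u i ≡ v i

weights : ∀ {n} → List (Subset n × ℚ) → ℚ
weights []             = 0ℚ
weights ((_ , w) ∷ ws) = w + weights ws

combo : ∀ {n} → List (Subset n × ℚ) → Vecℚ n
combo []             = λ _ → 0ℚ
combo ((A , w) ∷ ws) = (w ·ᵛ e A) +ᵛ combo ws

InP : ∀ {n} → Matroid n → Vecℚ n → Set
InP M x = ∃[ ws ] ( All (λ p → Matroid.Indep M (proj₁ p) × 0ℚ ≤ proj₂ p) ws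
                  × weights ws ≡ 1ℚ
                  × x ≈ᵛ combo ws )

InFace : ∀ {n} → Matroid n → Vecℚ n → Vecℚ n → Set
InFace M c x = InP M x × (∀ y → InP M y → ⟨ c , y ⟩ ≤ ⟨ c , x ⟩)

InSegment : ∀ {n} → Vecℚ n → Vecℚ n → Vecℚ n → Set
InSegment u v x = ∃[ t ] (0ℚ ≤ t × t ≤ 1ℚ × x ≈ᵛ ((t ·ᵛ u) +ᵛ ((1ℚ - t) ·ᵛ v)))

IsEdge : ∀ {n} → Matroid n → Subset n → Subset n → Set
IsEdge M A B = ∃[ c ] (∀ x → (InFace M c x → InSegment (e A) (e B) x)
                            × (InSegment (e A) (e B) x → InFace M c x))

-- Edge ⇒ unique decomposition: a functional c exposing [e_A, e_B] attains its maximum over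
-- the polytope at e_A and e_B; if e_A + e_B = e_C + e_D then ⟨c, e_C⟩ + ⟨c, e_D⟩ is twice that
-- maximum, so e_C lies on the face, i.e. on the segment, and a 0/1 point of it is an endpoint.
--
-- Unique decomposition ⇒ edge: every exchange that preserves e_A + e_B must be trivial.  If
-- |A| < |B|, augmenting A by b ∈ B ∖ A splits e_A + e_B as e_{A+b} + e_{B-b}, forcing B = A + b.
-- If |A| = |B|, pick a ∈ A ∖ B; the symmetric exchange property gives b ∈ B ∖ A with A - a + b
-- and B - b + a independent, forcing B = A - a + b, and A + b must be dependent.  The
-- functional w, equal to 2 on A ∩ B, -2 outside A ∪ B and 0 elsewhere, is maximal exactly at
-- the independent sets between A ∩ B and A ∪ B, and otherwise loses at least 2.  In the first
-- case w exposes [e_A, e_B]; in the second w + e_a + e_b does, the only competitor A + b being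
-- dependent.

module Submission where

open import Defs
open import Data.Bool using (Bool; true; false; if_then_else_)
import Data.Bool as Bool
open import Data.Empty using (⊥; ⊥-elim)
open import Data.Fin using (Fin; zero; suc; _≟_)
open import Data.Fin.Properties using (¬∀⟶∃¬; any?)
open import Data.Fin.Subset using (Subset; inside; outside; _∈_; _∉_; _⊆_; ⁅_⁆; _∪_; _─_; ∣_∣)
  renaming (⊥ to ∅)
open import Data.Fin.Subset.Properties
  using (_∈?_; ∉⊥; x∈p∪q⁻; p⊆p∪q; q⊆p∪q; x∈⁅x⁆; x∈⁅y⁆⇒x≡y; x∈p∧x≢y⇒x∈p-y; x∈p∧x∉q⇒x∈p─q; p─q⊆p;
         p⊂q⇒∣p∣<∣q∣; ⊆-antisym; ∪-identityʳ)
open import Data.List using (List; []; _∷_)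
open import Data.List.Relation.Unary.All using (All; []; _∷_)
open import Data.Nat as ℕ using (zero; suc)
import Data.Nat.Properties as ℕₚ
open import Data.Product using (Σ; ∃-syntax; _×_; _,_; proj₁; proj₂)
open import Data.Rational using (ℚ; 0ℚ; 1ℚ; _+_; _*_; _-_; -_; _≤_; _<_; _≤?_; _<?_; nonNegative; positive)
open import Data.Rational.Properties
  using (≤-refl; ≤-reflexive; ≤-trans; ≤-antisym; <⇒≤; <-irrefl; <-cmp; <-≤-trans; ≤-<-trans; positive⁻¹;
         +-comm; +-assoc; +-identityˡ; +-identityʳ; +-inverseʳ; +-mono-≤; +-monoˡ-≤; +-monoʳ-≤; +-monoʳ-<;
         *-comm; *-identityˡ; *-identityʳ; *-zeroˡ; *-zeroʳ; *-distribˡ-+; *-distribʳ-+;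
         *-monoˡ-≤-nonNeg; *-monoʳ-<-pos)
open import Data.Rational.Solver using (module +-*-Solver)
open import Data.Sum using (_⊎_; inj₁; inj₂)
import Data.Sum as Sum
open import Data.Vec using (_∷_; lookup; tabulate; here; there)
open import Data.Vec.Properties
  using (≡-dec; tabulate∘lookup; tabulate-cong; lookup∘tabulate; []=⇒lookup; lookup⇒[]=)
open import Function using (_∘′_; id)
open import Function.Bundles using (_⇔_; mk⇔)
open import Relation.Binary.Definitions using (DecidableEquality; tri<; tri≈; tri>)
open import Relation.Binary.PropositionalEquality
  using (_≡_; _≢_; refl; sym; trans; cong; cong₂; subst; subst₂; module ≡-Reasoning)
open import Relation.Nullary using (Dec; yes; no; does; ¬_)
open import Relation.Nullary.Decidable
  using (from-yes; decidable-stable; dec-true; dec-false; ¬?; _×-dec_; ¬¬-excluded-middle)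
open import Relation.Nullary.Negation using (¬¬-map)

open +-*-Solver using (solve; _:=_; _:+_; _:*_; _:-_; :-_; con)

-- Ordered field and finite sums

+-cancelʳ-≤ : ∀ c {a b} → a + c ≤ b + c → a ≤ b
+-cancelʳ-≤ c {a} {b} h = subst₂ _≤_ (cancel a) (cancel b) (+-monoˡ-≤ (- c) h)
  where
  cancel : ∀ x → x + c + - c ≡ x
  cancel x = solve 2 (λ x c → x :+ c :+ :- c := x) refl x c

tight-sumˡ : ∀ {a b c d} → a ≤ b → c ≤ d → a + c ≡ b + d → a ≡ b
tight-sumˡ {a} {b} {c} {d} a≤b c≤d eq =
  ≤-antisym a≤b (+-cancelʳ-≤ d (subst (_≤ a + d) eq (+-monoʳ-≤ a c≤d)))

tight-sumʳ : ∀ {a b c d} → a ≤ b → c ≤ d → a + c ≡ b + d → c ≡ d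
tight-sumʳ {a} {b} {c} {d} a≤b c≤d eq =
  tight-sumˡ c≤d a≤b (trans (+-comm c a) (trans eq (+-comm b d)))

+-cancelˡ-≡ : ∀ p {q r} → p + q ≡ p + r → q ≡ r
+-cancelˡ-≡ p {q} {r} eq = begin
  q             ≡⟨ solve 2 (λ p q → q := (p :+ q) :- p) refl p q ⟩
  (p + q) - p   ≡⟨ cong (_- p) eq ⟩
  (p + r) - p   ≡⟨ solve 2 (λ p r → (p :+ r) :- p := r) refl p r ⟩
  r             ∎
  where open ≡-Reasoning

0≤1 : 0ℚ ≤ 1ℚ
0≤1 = <⇒≤ (positive⁻¹ 1ℚ)

2ℚ : ℚ
2ℚ = 1ℚ + 1ℚ

+2≤⇒< : ∀ {p q} → p + 2ℚ ≤ q → p < q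
+2≤⇒< {p} p+2≤q = <-≤-trans (subst (_< p + 2ℚ) (+-identityʳ p) (+-monoʳ-< p (from-yes (0ℚ <? 2ℚ)))) p+2≤q

Σᶠ-cong : ∀ {n} {f g : Fin n → ℚ} → (∀ i → f i ≡ g i) → Σᶠ f ≡ Σᶠ g
Σᶠ-cong {zero}  f≗g = refl
Σᶠ-cong {suc n} f≗g = cong₂ _+_ (f≗g zero) (Σᶠ-cong (λ i → f≗g (suc i)))

Σᶠ-0 : ∀ n → Σᶠ {n} (λ _ → 0ℚ) ≡ 0ℚ
Σᶠ-0 zero    = refl
Σᶠ-0 (suc n) = trans (+-identityˡ _) (Σᶠ-0 n)

Σᶠ-+ : ∀ {n} (f g : Fin n → ℚ) → Σᶠ (λ i → f i + g i) ≡ Σᶠ f + Σᶠ g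
Σᶠ-+ {zero}  f g = sym (+-identityˡ 0ℚ)
Σᶠ-+ {suc n} f g = trans (cong (f zero + g zero +_) (Σᶠ-+ (λ i → f (suc i)) (λ i → g (suc i))))
  (solve 4 (λ a b c d → (a :+ b) :+ (c :+ d) := (a :+ c) :+ (b :+ d)) refl
    (f zero) (g zero) (Σᶠ (λ i → f (suc i))) (Σᶠ (λ i → g (suc i))))

Σᶠ-* : ∀ {n} t (f : Fin n → ℚ) → Σᶠ (λ i → t * f i) ≡ t * Σᶠ f
Σᶠ-* {zero}  t f = sym (*-zeroʳ t)
Σᶠ-* {suc n} t f = trans (cong (t * f zero +_) (Σᶠ-* t (λ i → f (suc i))))
  (sym (*-distribˡ-+ t (f zero) _))

Σᶠ-mono : ∀ {n} {f g : Fin n → ℚ} → (∀ i → f i ≤ g i) → Σᶠ f ≤ Σᶠ g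
Σᶠ-mono {zero}  f≤g = ≤-refl
Σᶠ-mono {suc n} f≤g = +-mono-≤ (f≤g zero) (Σᶠ-mono (λ i → f≤g (suc i)))

Σᶠ-tight-or-gap : ∀ {n} {P : Fin n → Set} {f g : Fin n → ℚ} d → 0ℚ ≤ d →
                  (∀ i → (P i × f i ≡ g i) ⊎ f i + d ≤ g i) →
                  ((∀ i → P i) × Σᶠ f ≡ Σᶠ g) ⊎ Σᶠ f + d ≤ Σᶠ g
Σᶠ-tight-or-gap {zero} d 0≤d terms = inj₁ ((λ ()) , refl)
Σᶠ-tight-or-gap {suc n} {P} {f} {g} d 0≤d terms
  with terms zero | Σᶠ-tight-or-gap {P = λ i → P (suc i)} d 0≤d (λ i → terms (suc i))
... | inj₁ (p₀ , eq₀) | inj₁ (ps , eqs) = inj₁ ((λ { zero → p₀ ; (suc i) → ps i }) , cong₂ _+_ eq₀ eqs)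
... | inj₁ (_ , eq₀)  | inj₂ gap =
  inj₂ (subst (_≤ _) (sym (+-assoc (f zero) _ d)) (+-mono-≤ (≤-reflexive eq₀) gap))
... | inj₂ gap₀ | _ =
  inj₂ (subst (_≤ _) (solve 3 (λ a s d → (a :+ d) :+ s := (a :+ s) :+ d) refl (f zero) _ d)
         (+-mono-≤ gap₀ (Σᶠ-mono (λ i → term-≤ (terms (suc i))))))
  where
  term-≤ : ∀ {p x y} → (p × x ≡ y) ⊎ x + d ≤ y → x ≤ y
  term-≤ (inj₁ (_ , x≡y)) = ≤-reflexive x≡y
  term-≤ {x = x} (inj₂ x+d≤y) = ≤-trans (subst (_≤ x + d) (+-identityʳ x) (+-monoʳ-≤ x 0≤d)) x+d≤y

⟨⟩-congʳ : ∀ {n} (c : Vecℚ n) {u v} → u ≈ᵛ v → ⟨ c , u ⟩ ≡ ⟨ c , v ⟩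
⟨⟩-congʳ c u≈v = Σᶠ-cong (λ i → cong (c i *_) (u≈v i))

⟨⟩-+ʳ : ∀ {n} (c u v : Vecℚ n) → ⟨ c , u +ᵛ v ⟩ ≡ ⟨ c , u ⟩ + ⟨ c , v ⟩
⟨⟩-+ʳ c u v = trans (Σᶠ-cong (λ i → *-distribˡ-+ (c i) (u i) (v i))) (Σᶠ-+ (λ i → c i * u i) (λ i → c i * v i))

⟨⟩-+ˡ : ∀ {n} (c d u : Vecℚ n) → ⟨ c +ᵛ d , u ⟩ ≡ ⟨ c , u ⟩ + ⟨ d , u ⟩
⟨⟩-+ˡ c d u = trans (Σᶠ-cong (λ i → *-distribʳ-+ (u i) (c i) (d i))) (Σᶠ-+ (λ i → c i * u i) (λ i → d i * u i))

⟨⟩-·ʳ : ∀ {n} (c : Vecℚ n) t u → ⟨ c , t ·ᵛ u ⟩ ≡ t * ⟨ c , u ⟩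
⟨⟩-·ʳ c t u = trans (Σᶠ-cong (λ i → solve 3 (λ c t u → c :* (t :* u) := t :* (c :* u)) refl (c i) t (u i)))
                    (Σᶠ-* t (λ i → c i * u i))

⟨⟩-0ʳ : ∀ {n} (c : Vecℚ n) → ⟨ c , (λ _ → 0ℚ) ⟩ ≡ 0ℚ
⟨⟩-0ʳ {n} c = trans (Σᶠ-cong (λ i → *-zeroʳ (c i))) (Σᶠ-0 n)

-- Finite sets

true≢false : true ≢ false
true≢false ()

lookup-ext : ∀ {n} {p q : Subset n} → (∀ i → lookup p i ≡ lookup q i) → p ≡ q
lookup-ext {p = p} {q} p≗q = trans (sym (tabulate∘lookup p)) (trans (tabulate-cong p≗q) (tabulate∘lookup q))

lookup-ext-at : ∀ {n} {p q : Subset n} k → lookup p k ≡ lookup q k →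
                (∀ i → i ≢ k → lookup p i ≡ lookup q i) → p ≡ q
lookup-ext-at {p = p} {q} k at-k off-k = lookup-ext pointwise
  where
  pointwise : ∀ i → lookup p i ≡ lookup q i
  pointwise i with i ≟ k
  ... | yes refl = at-k
  ... | no i≢k   = off-k i i≢k

lookup-ext-at₂ : ∀ {n} {p q : Subset n} k l → lookup p k ≡ lookup q k → lookup p l ≡ lookup q l →
                 (∀ i → i ≢ k → i ≢ l → lookup p i ≡ lookup q i) → p ≡ q
lookup-ext-at₂ {p = p} {q} k l at-k at-l off = lookup-ext-at k at-k off-k
  where
  off-k : ∀ i → i ≢ k → lookup p i ≡ lookup q i
  off-k i i≢k with i ≟ l
  ... | yes refl = at-l
  ... | no i≢l   = off i i≢k i≢l

other-bit : ∀ {a b c : Bool} → a ≢ b → c ≢ a → c ≡ b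
other-bit {true}  {true}  a≢b _   = ⊥-elim (a≢b refl)
other-bit {false} {false} a≢b _   = ⊥-elim (a≢b refl)
other-bit {true}  {false} {false} _ _ = refl
other-bit {false} {true}  {true}  _ _ = refl
other-bit {true}  {false} {true}  _ c≢a = ⊥-elim (c≢a refl)
other-bit {false} {true}  {false} _ c≢a = ⊥-elim (c≢a refl)

x∈p∪⁅y⁆⁻ : ∀ {n} {x y : Fin n} (p : Subset n) → x ∈ p ∪ ⁅ y ⁆ → x ∈ p ⊎ x ≡ y
x∈p∪⁅y⁆⁻ {y = y} p x∈ = Sum.map₂ (x∈⁅y⁆⇒x≡y y) (x∈p∪q⁻ p ⁅ y ⁆ x∈)

x∈p─q⇒x∉q : ∀ {n} {x : Fin n} (p q : Subset n) → x ∈ p ─ q → x ∉ q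
x∈p─q⇒x∉q {x = zero}  (s ∷ p) (outside ∷ q) _          ()
x∈p─q⇒x∉q {x = zero}  (s ∷ p) (inside ∷ q)  ()         _
x∈p─q⇒x∉q {x = suc x} (s ∷ p) (t ∷ q)       (there x∈) (there x∈q) = x∈p─q⇒x∉q p q x∈ x∈q

x∈p─⁅y⁆⇒x≢y : ∀ {n} {x y : Fin n} (p : Subset n) → x ∈ p ─ ⁅ y ⁆ → x ≢ y
x∈p─⁅y⁆⇒x≢y {y = y} p x∈ refl = x∈p─q⇒x∉q p ⁅ y ⁆ x∈ (x∈⁅x⁆ y)

∈⇔⇒lookup≡ : ∀ {n} {x : Fin n} {p q : Subset n} → (x ∈ p → x ∈ q) → (x ∈ q → x ∈ p) →
           lookup p x ≡ lookup q x
∈⇔⇒lookup≡ {x = x} {p} {q} p⇒q q⇒p with lookup p x in px | lookup q x in qx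
... | true  | true  = refl
... | false | false = refl
... | true  | false = ⊥-elim (true≢false (trans (sym ([]=⇒lookup (p⇒q (lookup⇒[]= x p px)))) qx))
... | false | true  = ⊥-elim (true≢false (trans (sym ([]=⇒lookup (q⇒p (lookup⇒[]= x q qx)))) px))

∉⇒lookup≡false : ∀ {n} {x : Fin n} {p : Subset n} → x ∉ p → lookup p x ≡ false
∉⇒lookup≡false {x = x} {p} x∉p with lookup p x in px
... | true  = ⊥-elim (x∉p (lookup⇒[]= x p px))
... | false = refl

lookup-∪⁅x⁆-x : ∀ {n} {x : Fin n} (p : Subset n) → lookup (p ∪ ⁅ x ⁆) x ≡ true
lookup-∪⁅x⁆-x {x = x} p = []=⇒lookup (q⊆p∪q p ⁅ x ⁆ (x∈⁅x⁆ x))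

lookup-─⁅x⁆-x : ∀ {n} {x : Fin n} (p : Subset n) → lookup (p ─ ⁅ x ⁆) x ≡ false
lookup-─⁅x⁆-x p = ∉⇒lookup≡false (λ x∈ → x∈p─⁅y⁆⇒x≢y p x∈ refl)

lookup-∪⁅y⁆-x : ∀ {n} {x y : Fin n} (p : Subset n) → x ≢ y → lookup (p ∪ ⁅ y ⁆) x ≡ lookup p x
lookup-∪⁅y⁆-x p x≢y = ∈⇔⇒lookup≡ (λ x∈ → Sum.[ id , ⊥-elim ∘′ x≢y ] (x∈p∪⁅y⁆⁻ p x∈)) (p⊆p∪q _)

lookup-─⁅y⁆-x : ∀ {n} {x y : Fin n} (p : Subset n) → x ≢ y → lookup (p ─ ⁅ y ⁆) x ≡ lookup p x
lookup-─⁅y⁆-x p x≢y = ∈⇔⇒lookup≡ (p─q⊆p p _) (λ x∈p → x∈p∧x≢y⇒x∈p-y x∈p x≢y)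

swapped-lookup : ∀ {n} {a b i : Fin n} (A : Subset n) → i ≢ a → i ≢ b →
                 lookup ((A ─ ⁅ a ⁆) ∪ ⁅ b ⁆) i ≡ lookup A i
swapped-lookup A i≢a i≢b = trans (lookup-∪⁅y⁆-x (A ─ ⁅ _ ⁆) i≢b) (lookup-─⁅y⁆-x A i≢a)

∣p∪⁅x⁆∣≡1+∣p∣ : ∀ {n} {x : Fin n} (p : Subset n) → x ∉ p → ∣ p ∪ ⁅ x ⁆ ∣ ≡ suc ∣ p ∣
∣p∪⁅x⁆∣≡1+∣p∣ {x = zero}  (inside ∷ p)  x∉ = ⊥-elim (x∉ here)
∣p∪⁅x⁆∣≡1+∣p∣ {x = zero}  (outside ∷ p) _  = cong (suc ∘′ ∣_∣) (∪-identityʳ p)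
∣p∪⁅x⁆∣≡1+∣p∣ {x = suc x} (inside ∷ p)  x∉ = cong suc (∣p∪⁅x⁆∣≡1+∣p∣ p (x∉ ∘′ there))
∣p∪⁅x⁆∣≡1+∣p∣ {x = suc x} (outside ∷ p) x∉ = ∣p∪⁅x⁆∣≡1+∣p∣ p (x∉ ∘′ there)

p─⁅x⁆∪⁅x⁆≡p : ∀ {n} {x : Fin n} {p : Subset n} → x ∈ p → (p ─ ⁅ x ⁆) ∪ ⁅ x ⁆ ≡ p
p─⁅x⁆∪⁅x⁆≡p {x = x} {p} x∈p = ⊆-antisym ⊆p p⊆
  where
  ⊆p : (p ─ ⁅ x ⁆) ∪ ⁅ x ⁆ ⊆ p
  ⊆p y∈ with x∈p∪⁅y⁆⁻ (p ─ ⁅ x ⁆) y∈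
  ... | inj₁ y∈p─x = p─q⊆p p ⁅ x ⁆ y∈p─x
  ... | inj₂ refl  = x∈p
  p⊆ : p ⊆ (p ─ ⁅ x ⁆) ∪ ⁅ x ⁆
  p⊆ {y} y∈p with y ≟ x
  ... | yes refl = q⊆p∪q (p ─ ⁅ x ⁆) ⁅ x ⁆ (x∈⁅x⁆ x)
  ... | no y≢x   = p⊆p∪q ⁅ x ⁆ (x∈p∧x≢y⇒x∈p-y y∈p y≢x)

∣p∣≡1+∣p─⁅x⁆∣ : ∀ {n} {x : Fin n} {p : Subset n} → x ∈ p → ∣ p ∣ ≡ suc ∣ p ─ ⁅ x ⁆ ∣
∣p∣≡1+∣p─⁅x⁆∣ {x = x} {p} x∈p =
  trans (cong ∣_∣ (sym (p─⁅x⁆∪⁅x⁆≡p x∈p))) (∣p∪⁅x⁆∣≡1+∣p∣ (p ─ ⁅ x ⁆) (λ x∈ → x∈p─⁅y⁆⇒x≢y p x∈ refl))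

p⊆q∧∣q∣≤∣p∣⇒q⊆p : ∀ {n} {p q : Subset n} → p ⊆ q → ∣ q ∣ ℕ.≤ ∣ p ∣ → q ⊆ p
p⊆q∧∣q∣≤∣p∣⇒q⊆p {p = p} p⊆q ∣q∣≤∣p∣ {x} x∈q =
  decidable-stable (x ∈? p) (λ x∉p → ℕₚ.<⇒≱ (p⊂q⇒∣p∣<∣q∣ (p⊆q , x , x∈q , x∉p)) ∣q∣≤∣p∣)

y∈q⇒p∪⁅y⁆∪q⊆p∪q : ∀ {n} {y : Fin n} (p q : Subset n) → y ∈ q → (p ∪ ⁅ y ⁆) ∪ q ⊆ p ∪ q
y∈q⇒p∪⁅y⁆∪q⊆p∪q p q y∈q x∈ with x∈p∪q⁻ (p ∪ ⁅ _ ⁆) q x∈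
... | inj₂ x∈q = q⊆p∪q p q x∈q
... | inj₁ x∈p+y with x∈p∪⁅y⁆⁻ p x∈p+y
...   | inj₁ x∈p  = p⊆p∪q q x∈p
...   | inj₂ refl = q⊆p∪q p q y∈q

infix 4 _≟ₛ_
_≟ₛ_ : ∀ {n} → DecidableEquality (Subset n)
_≟ₛ_ = ≡-dec Bool._≟_

element-of-difference : ∀ {n} {A B : Subset n} → ∣ B ∣ ℕ.≤ ∣ A ∣ → A ≢ B → ∃[ a ] (a ∈ A × a ∉ B)
element-of-difference {A = A} {B} ∣B∣≤∣A∣ A≢B with any? (λ a → a ∈? A ×-dec ¬? (a ∈? B))
... | yes found = found
... | no none = ⊥-elim (A≢B (⊆-antisym A⊆B (p⊆q∧∣q∣≤∣p∣⇒q⊆p A⊆B ∣B∣≤∣A∣)))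
  where
  A⊆B : A ⊆ B
  A⊆B {x} x∈A = decidable-stable (x ∈? B) (λ x∉B → none (x , x∈A , x∉B))

select : ∀ {n} {P : Fin n → Set} → (∀ x → Dec (P x)) → Subset n
select P? = tabulate (λ x → does (P? x))

∈select⁺ : ∀ {n} {P : Fin n → Set} (P? : ∀ x → Dec (P x)) {x} → P x → x ∈ select P?
∈select⁺ P? {x} Px = lookup⇒[]= x (select P?) (trans (lookup∘tabulate _ x) (dec-true (P? x) Px))

∈select⁻ : ∀ {n} {P : Fin n → Set} (P? : ∀ x → Dec (P x)) {x} → x ∈ select P? → P x
∈select⁻ P? {x} x∈ = decidable-stable (P? x) λ ¬Px →
  true≢false (trans (sym (trans (sym (lookup∘tabulate _ x)) ([]=⇒lookup x∈))) (dec-false (P? x) ¬Px))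

¬¬-dec-∀ : ∀ {n} (P : Fin n → Set) → ¬ ¬ (∀ i → Dec (P i))
¬¬-dec-∀ {zero}  P no-dec = no-dec (λ ())
¬¬-dec-∀ {suc n} P no-dec = ¬¬-excluded-middle λ P₀? →
  ¬¬-dec-∀ (λ i → P (suc i)) λ Pₛ? → no-dec λ { zero → P₀? ; (suc i) → Pₛ? i }

-- Indicator vectors

bit : Bool → ℚ
bit b = if b then 1ℚ else 0ℚ

bit-injective : ∀ {a b} → bit a ≡ bit b → a ≡ b
bit-injective {true}  {true}  _ = refl
bit-injective {false} {false} _ = refl
bit-injective {true}  {false} ()
bit-injective {false} {true}  ()

e-injective : ∀ {n} {p q : Subset n} → e p ≈ᵛ e q → p ≡ q
e-injective ep≈eq = lookup-ext (λ i → bit-injective (ep≈eq i))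

differing-coordinate : ∀ {n} {p q : Subset n} → p ≢ q → ∃[ k ] lookup p k ≢ lookup q k
differing-coordinate {n} {p} {q} p≢q =
  ¬∀⟶∃¬ n (λ i → lookup p i ≡ lookup q i) (λ i → lookup p i Bool.≟ lookup q i) (p≢q ∘′ lookup-ext)

+ᵛ-cancelˡ : ∀ {n} {p q r : Subset n} → (e p +ᵛ e q) ≈ᵛ (e p +ᵛ e r) → q ≡ r
+ᵛ-cancelˡ {p = p} sum≈ = e-injective (λ i → +-cancelˡ-≡ (e p i) (sum≈ i))

e-∈ : ∀ {n} {x : Fin n} {p : Subset n} → x ∈ p → e p x ≡ 1ℚ
e-∈ x∈p = cong bit ([]=⇒lookup x∈p)

e-∉ : ∀ {n} {x : Fin n} {p : Subset n} → x ∉ p → e p x ≡ 0ℚ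
e-∉ x∉p = cong bit (∉⇒lookup≡false x∉p)

⟨e⁅⁆,_⟩ : ∀ {n} (k : Fin n) (u : Vecℚ n) → ⟨ e ⁅ k ⁆ , u ⟩ ≡ u k
⟨e⁅⁆,_⟩ {suc n} zero u = trans (cong (1ℚ * u zero +_) rest≡0) (trans (+-identityʳ _) (*-identityˡ (u zero)))
  where
  rest≡0 : Σᶠ (λ i → e ∅ i * u (suc i)) ≡ 0ℚ
  rest≡0 = trans (Σᶠ-cong (λ i → trans (cong (_* u (suc i)) (e-∉ {p = ∅} (∉⊥ {x = i}))) (*-zeroˡ (u (suc i)))))
                 (Σᶠ-0 n)
⟨e⁅⁆,_⟩ {suc n} (suc k) u = trans (cong₂ _+_ (*-zeroˡ (u zero)) (⟨e⁅⁆,_⟩ k (λ i → u (suc i)))) (+-identityˡ _)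

bits-kept : ∀ {a b c d} → c ≡ a → d ≡ b → bit a + bit b ≡ bit c + bit d
bits-kept refl refl = refl

bits-swapped : ∀ {a b c d} → c ≡ b → d ≡ a → bit a + bit b ≡ bit c + bit d
bits-swapped {a} {b} refl refl = +-comm (bit a) (bit b)

e-sum-adding : ∀ {n} {A B : Subset n} {b} → b ∈ B → b ∉ A →
               (e A +ᵛ e B) ≈ᵛ (e (A ∪ ⁅ b ⁆) +ᵛ e (B ─ ⁅ b ⁆))
e-sum-adding {A = A} {B} {b} b∈B b∉A i with i ≟ b
... | yes refl = bits-swapped (trans (lookup-∪⁅x⁆-x A) (sym ([]=⇒lookup b∈B)))
                              (trans (lookup-─⁅x⁆-x B) (sym (∉⇒lookup≡false b∉A)))
... | no i≢b   = bits-kept (lookup-∪⁅y⁆-x A i≢b) (lookup-─⁅y⁆-x B i≢b)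

e-sum-swapping : ∀ {n} {A B : Subset n} {a b} → a ∈ A → a ∉ B → b ∈ B → b ∉ A →
                 (e A +ᵛ e B) ≈ᵛ (e ((A ─ ⁅ a ⁆) ∪ ⁅ b ⁆) +ᵛ e ((B ─ ⁅ b ⁆) ∪ ⁅ a ⁆))
e-sum-swapping {A = A} {B} {a} {b} a∈A a∉B b∈B b∉A i with i ≟ a | i ≟ b
... | yes refl | _ = bits-swapped
  (trans (lookup-∪⁅y⁆-x (A ─ ⁅ a ⁆) a≢b) (trans (lookup-─⁅x⁆-x A) (sym (∉⇒lookup≡false a∉B))))
  (trans (lookup-∪⁅x⁆-x (B ─ ⁅ b ⁆)) (sym ([]=⇒lookup a∈A)))
  where a≢b = λ { refl → a∉B b∈B }
... | no i≢a | yes refl = bits-swapped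
  (trans (lookup-∪⁅x⁆-x (A ─ ⁅ a ⁆)) (sym ([]=⇒lookup b∈B)))
  (trans (lookup-∪⁅y⁆-x (B ─ ⁅ b ⁆) i≢a) (trans (lookup-─⁅x⁆-x B) (sym (∉⇒lookup≡false b∉A))))
... | no i≢a | no i≢b = bits-kept (swapped-lookup A i≢a i≢b) (swapped-lookup B i≢b i≢a)

bit+bit≤2 : ∀ a b → bit a + bit b ≤ 2ℚ
bit+bit≤2 true  true  = from-yes (1ℚ + 1ℚ ≤? 2ℚ)
bit+bit≤2 true  false = from-yes (1ℚ + 0ℚ ≤? 2ℚ)
bit+bit≤2 false true  = from-yes (0ℚ + 1ℚ ≤? 2ℚ)
bit+bit≤2 false false = from-yes (0ℚ + 0ℚ ≤? 2ℚ)

-- Faces of the independence polytope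

weighted-value : ∀ {n} → Vecℚ n → List (Subset n × ℚ) → ℚ
weighted-value c []             = 0ℚ
weighted-value c ((C , w) ∷ ws) = w * ⟨ c , e C ⟩ + weighted-value c ws

⟨⟩-combo : ∀ {n} (c : Vecℚ n) ws → ⟨ c , combo ws ⟩ ≡ weighted-value c ws
⟨⟩-combo c []             = ⟨⟩-0ʳ c
⟨⟩-combo c ((C , w) ∷ ws) = begin
  ⟨ c , (w ·ᵛ e C) +ᵛ combo ws ⟩         ≡⟨ ⟨⟩-+ʳ c (w ·ᵛ e C) (combo ws) ⟩
  ⟨ c , w ·ᵛ e C ⟩ + ⟨ c , combo ws ⟩     ≡⟨ cong₂ _+_ (⟨⟩-·ʳ c w (e C)) (⟨⟩-combo c ws) ⟩
  w * ⟨ c , e C ⟩ + weighted-value c ws  ∎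
  where open ≡-Reasoning

module _ {n} (M : Matroid n) where
  open Matroid M

  Admissible : List (Subset n × ℚ) → Set
  Admissible = All (λ p → Indep (proj₁ p) × 0ℚ ≤ proj₂ p)

  vertex∈P : ∀ {C} → Indep C → InP M (e C)
  vertex∈P {C} iC = (C , 1ℚ) ∷ [] , (iC , 0≤1) ∷ [] , +-identityʳ 1ℚ ,
    λ i → solve 1 (λ x → x := con 1ℚ :* x :+ con 0ℚ) refl (e C i)

  segment∈P : ∀ {A B x} → Indep A → Indep B → InSegment (e A) (e B) x → InP M x
  segment∈P {A} {B} iA iB (t , 0≤t , t≤1 , x≈) =
    (A , t) ∷ (B , 1ℚ - t) ∷ [] , (iA , 0≤t) ∷ (iB , 0≤1-t) ∷ [] ,
    solve 1 (λ t → t :+ ((con 1ℚ :- t) :+ con 0ℚ) := con 1ℚ) refl t ,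
    λ i → trans (x≈ i) (solve 3 (λ t a b → t :* a :+ (con 1ℚ :- t) :* b
                                         := t :* a :+ ((con 1ℚ :- t) :* b :+ con 0ℚ)) refl t (e A i) (e B i))
    where
    0≤1-t : 0ℚ ≤ 1ℚ - t
    0≤1-t = subst (_≤ 1ℚ - t) (+-inverseʳ t) (+-monoˡ-≤ (- t) t≤1)

  module _ {A B : Subset n} (c : Vecℚ n) (m : ℚ) (iA : Indep A) (iB : Indep B)
           (cA : ⟨ c , e A ⟩ ≡ m) (cB : ⟨ c , e B ⟩ ≡ m)
           (below : ∀ C → Indep C → ⟨ c , e C ⟩ < m ⊎ (C ≡ A ⊎ C ≡ B)) where

    vertex-≤ : ∀ {C} → Indep C → ⟨ c , e C ⟩ ≤ m
    vertex-≤ {C} iC with below C iC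
    ... | inj₁ <m          = <⇒≤ <m
    ... | inj₂ (inj₁ refl) = ≤-reflexive cA
    ... | inj₂ (inj₂ refl) = ≤-reflexive cB

    weighted-≤ : ∀ {ws} → Admissible ws → weighted-value c ws ≤ m * weights ws
    weighted-≤ [] = ≤-reflexive (sym (*-zeroʳ m))
    weighted-≤ {(C , w) ∷ ws} ((iC , 0≤w) ∷ adm) =
      subst (_ ≤_) (trans (cong (_+ m * weights ws) (*-comm w m)) (sym (*-distribˡ-+ m w (weights ws))))
        (+-mono-≤ (*-monoˡ-≤-nonNeg w {{nonNegative 0≤w}} (vertex-≤ iC)) (weighted-≤ adm))

    P-≤ : ∀ y → InP M y → ⟨ c , y ⟩ ≤ m
    P-≤ y (ws , adm , Σw≡1 , y≈) =
      subst₂ _≤_ (sym (trans (⟨⟩-congʳ c y≈) (⟨⟩-combo c ws))) (trans (cong (m *_) Σw≡1) (*-identityʳ m))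
        (weighted-≤ adm)

    Concentrated : List (Subset n × ℚ) → Set
    Concentrated ws = Σ ℚ λ tA → Σ ℚ λ tB → 0ℚ ≤ tA × 0ℚ ≤ tB × tA + tB ≡ weights ws ×
                      combo ws ≈ᵛ ((tA ·ᵛ e A) +ᵛ (tB ·ᵛ e B))

    maximal-term : ∀ {C w} → Indep C → 0ℚ ≤ w → w * ⟨ c , e C ⟩ ≡ w * m →
                   w ≡ 0ℚ ⊎ (C ≡ A ⊎ C ≡ B)
    maximal-term {C} {w} iC 0≤w eq with below C iC
    ... | inj₂ C∈AB = inj₂ C∈AB
    ... | inj₁ <m with <-cmp 0ℚ w
    ...   | tri< 0<w _ _ = ⊥-elim (<-irrefl eq (*-monoʳ-<-pos w {{positive 0<w}} <m))
    ...   | tri≈ _ 0≡w _ = inj₁ (sym 0≡w)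
    ...   | tri> _ _ w<0 = ⊥-elim (<-irrefl refl (<-≤-trans w<0 0≤w))

    cons-concentrated : ∀ {C w ws} → 0ℚ ≤ w → w ≡ 0ℚ ⊎ (C ≡ A ⊎ C ≡ B) →
                        Concentrated ws → Concentrated ((C , w) ∷ ws)
    cons-concentrated {C} {w} {ws} _ (inj₁ refl) (tA , tB , 0≤tA , 0≤tB , Σt , x≈) =
      tA , tB , 0≤tA , 0≤tB , trans Σt (sym (+-identityˡ (weights ws))) ,
      λ i → trans (cong₂ _+_ (*-zeroˡ (e C i)) (x≈ i)) (+-identityˡ _)
    cons-concentrated {C} {w} 0≤w (inj₂ (inj₁ refl)) (tA , tB , 0≤tA , 0≤tB , Σt , x≈) =
      w + tA , tB , +-mono-≤ 0≤w 0≤tA , 0≤tB , trans (+-assoc w tA tB) (cong (w +_) Σt) ,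
      λ i → trans (cong (w * e C i +_) (x≈ i))
        (solve 5 (λ w a b ea eb → w :* ea :+ (a :* ea :+ b :* eb) := (w :+ a) :* ea :+ b :* eb)
          refl w tA tB (e A i) (e B i))
    cons-concentrated {C} {w} 0≤w (inj₂ (inj₂ refl)) (tA , tB , 0≤tA , 0≤tB , Σt , x≈) =
      tA , w + tB , 0≤tA , +-mono-≤ 0≤w 0≤tB ,
      trans (solve 3 (λ w a b → a :+ (w :+ b) := w :+ (a :+ b)) refl w tA tB) (cong (w +_) Σt) ,
      λ i → trans (cong (w * e C i +_) (x≈ i))
        (solve 5 (λ w a b ea eb → w :* eb :+ (a :* ea :+ b :* eb) := a :* ea :+ (w :+ b) :* eb)
          refl w tA tB (e A i) (e B i))

    concentrated : ∀ {ws} → Admissible ws → m * weights ws ≤ weighted-value c ws → Concentrated ws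
    concentrated [] _ = 0ℚ , 0ℚ , ≤-refl , ≤-refl , refl ,
      λ i → solve 2 (λ a b → con 0ℚ := con 0ℚ :* a :+ con 0ℚ :* b) refl (e A i) (e B i)
    concentrated {(C , w) ∷ ws} ((iC , 0≤w) ∷ adm) reaches =
      cons-concentrated {ws = ws} 0≤w (maximal-term iC 0≤w head-tight) (concentrated adm tail-reaches)
      where
      head-≤ : w * ⟨ c , e C ⟩ ≤ w * m
      head-≤ = *-monoˡ-≤-nonNeg w {{nonNegative 0≤w}} (vertex-≤ iC)
      total : w * ⟨ c , e C ⟩ + weighted-value c ws ≡ w * m + m * weights ws
      total = ≤-antisym (+-mono-≤ head-≤ (weighted-≤ adm))
        (subst (_≤ _) (solve 3 (λ m w W → m :* (w :+ W) := w :* m :+ m :* W) refl m w (weights ws)) reaches)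
      head-tight : w * ⟨ c , e C ⟩ ≡ w * m
      head-tight = tight-sumˡ head-≤ (weighted-≤ adm) total
      tail-reaches : m * weights ws ≤ weighted-value c ws
      tail-reaches = ≤-reflexive (sym (tight-sumʳ head-≤ (weighted-≤ adm) total))

    face⇒segment : ∀ x → InFace M c x → InSegment (e A) (e B) x
    face⇒segment x ((ws , adm , Σw≡1 , x≈) , maximal) = on-segment (concentrated adm reaches)
      where
      reaches : m * weights ws ≤ weighted-value c ws
      reaches = subst₂ _≤_ (trans cA (sym (trans (cong (m *_) Σw≡1) (*-identityʳ m))))
                           (trans (⟨⟩-congʳ c x≈) (⟨⟩-combo c ws)) (maximal (e A) (vertex∈P iA))
      on-segment : Concentrated ws → InSegment (e A) (e B) x
      on-segment (tA , tB , 0≤tA , 0≤tB , Σt , x≈′) =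
        tA , 0≤tA , subst (tA ≤_) Σt′ (subst (_≤ tA + tB) (+-identityʳ tA) (+-monoʳ-≤ tA 0≤tB)) ,
        λ i → trans (x≈ i) (trans (x≈′ i) (cong (λ s → tA * e A i + s * e B i) tB≡))
        where
        Σt′ : tA + tB ≡ 1ℚ
        Σt′ = trans Σt Σw≡1
        tB≡ : tB ≡ 1ℚ - tA
        tB≡ = trans (solve 2 (λ a b → b := (a :+ b) :- a) refl tA tB) (cong (_- tA) Σt′)

    segment⇒face : ∀ x → InSegment (e A) (e B) x → InFace M c x
    segment⇒face x seg@(t , _ , _ , x≈) =
      segment∈P iA iB seg , λ y y∈P → subst (⟨ c , y ⟩ ≤_) (sym value) (P-≤ y y∈P)
      where
      value : ⟨ c , x ⟩ ≡ m
      value = begin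
        ⟨ c , x ⟩
          ≡⟨ ⟨⟩-congʳ c x≈ ⟩
        ⟨ c , (t ·ᵛ e A) +ᵛ ((1ℚ - t) ·ᵛ e B) ⟩
          ≡⟨ ⟨⟩-+ʳ c _ _ ⟩
        ⟨ c , t ·ᵛ e A ⟩ + ⟨ c , (1ℚ - t) ·ᵛ e B ⟩
          ≡⟨ cong₂ _+_ (⟨⟩-·ʳ c t (e A)) (⟨⟩-·ʳ c (1ℚ - t) (e B)) ⟩
        t * ⟨ c , e A ⟩ + (1ℚ - t) * ⟨ c , e B ⟩
          ≡⟨ cong₂ (λ p q → t * p + (1ℚ - t) * q) cA cB ⟩
        t * m + (1ℚ - t) * m
          ≡⟨ solve 2 (λ t m → t :* m :+ (con 1ℚ :- t) :* m := m) refl t m ⟩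
        m ∎
        where open ≡-Reasoning

    exposed-edge : IsEdge M A B
    exposed-edge = c , λ x → face⇒segment x , segment⇒face x

vertex-on-segment : ∀ {n} {A B C : Subset n} → A ≢ B → InSegment (e A) (e B) (e C) → C ≡ A ⊎ C ≡ B
vertex-on-segment {A = A} {B} {C} A≢B (t , _ , _ , eC≈) with differing-coordinate A≢B
... | k , Ak≢Bk = Sum.map at-1 at-0 (t∈01 (lookup A k) (lookup B k) (lookup C k) Ak≢Bk (eC≈ k))
  where
  1-1-t≡t : 1ℚ - (1ℚ - t) ≡ t
  1-1-t≡t = solve 1 (λ t → con 1ℚ :- (con 1ℚ :- t) := t) refl t
  t·1+[1-t]·0≡t : t * 1ℚ + (1ℚ - t) * 0ℚ ≡ t
  t·1+[1-t]·0≡t = solve 1 (λ t → t :* con 1ℚ :+ (con 1ℚ :- t) :* con 0ℚ := t) refl t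
  t·0+[1-t]·1≡1-t : t * 0ℚ + (1ℚ - t) * 1ℚ ≡ 1ℚ - t
  t·0+[1-t]·1≡1-t = solve 1 (λ t → t :* con 0ℚ :+ (con 1ℚ :- t) :* con 1ℚ := con 1ℚ :- t) refl t
  t∈01 : ∀ a b c → a ≢ b → bit c ≡ t * bit a + (1ℚ - t) * bit b → t ≡ 1ℚ ⊎ t ≡ 0ℚ
  t∈01 true  true  _     a≢b _  = ⊥-elim (a≢b refl)
  t∈01 false false _     a≢b _  = ⊥-elim (a≢b refl)
  t∈01 true  false true  _   eq = inj₁ (sym (trans eq t·1+[1-t]·0≡t))
  t∈01 true  false false _   eq = inj₂ (sym (trans eq t·1+[1-t]·0≡t))
  t∈01 false true  true  _   eq = inj₂ (trans (sym 1-1-t≡t) (cong (λ s → 1ℚ - s) (sym (trans eq t·0+[1-t]·1≡1-t))))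
  t∈01 false true  false _   eq = inj₁ (trans (sym 1-1-t≡t) (cong (λ s → 1ℚ - s) (sym (trans eq t·0+[1-t]·1≡1-t))))
  at-1 : t ≡ 1ℚ → C ≡ A
  at-1 refl = e-injective λ i → trans (eC≈ i)
    (solve 2 (λ a b → con 1ℚ :* a :+ (con 1ℚ :- con 1ℚ) :* b := a) refl (e A i) (e B i))
  at-0 : t ≡ 0ℚ → C ≡ B
  at-0 refl = e-injective λ i → trans (eC≈ i)
    (solve 2 (λ a b → con 0ℚ :* a :+ (con 1ℚ :- con 0ℚ) :* b := b) refl (e A i) (e B i))

UniqueDecomposition : ∀ {n} → Matroid n → Subset n → Subset n → Set
UniqueDecomposition M A B = ∀ C D → Matroid.Indep M C → Matroid.Indep M D →
  (e A +ᵛ e B) ≈ᵛ (e C +ᵛ e D) → (C ≡ A × D ≡ B) ⊎ (C ≡ B × D ≡ A)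

source∈segment : ∀ {n} (u v : Vecℚ n) → InSegment u v u
source∈segment u v = 1ℚ , 0≤1 , ≤-refl ,
  λ i → solve 2 (λ a b → a := con 1ℚ :* a :+ (con 1ℚ :- con 1ℚ) :* b) refl (u i) (v i)

target∈segment : ∀ {n} (u v : Vecℚ n) → InSegment u v v
target∈segment u v = 0ℚ , ≤-refl , 0≤1 ,
  λ i → solve 2 (λ a b → b := con 0ℚ :* a :+ (con 1ℚ :- con 0ℚ) :* b) refl (u i) (v i)

edge⇒unique-decomposition : ∀ {n} (M : Matroid n) {A B} → Matroid.Indep M A → Matroid.Indep M B →
                            A ≢ B → IsEdge M A B → UniqueDecomposition M A B
edge⇒unique-decomposition M {A} {B} iA iB A≢B (c , face⇔segment) C D iC iD sum≈ =
  partner (vertex-on-segment A≢B (proj₁ (face⇔segment (e C)) C-on-face))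
  where
  maximal : ∀ y → InP M y → ⟨ c , y ⟩ ≤ ⟨ c , e A ⟩
  maximal = proj₂ (proj₂ (face⇔segment (e A)) (source∈segment (e A) (e B)))
  cA≡cB : ⟨ c , e A ⟩ ≡ ⟨ c , e B ⟩
  cA≡cB = ≤-antisym (proj₂ (proj₂ (face⇔segment (e B)) (target∈segment (e A) (e B))) (e A) (vertex∈P M iA))
                    (maximal (e B) (vertex∈P M iB))
  values : ⟨ c , e C ⟩ + ⟨ c , e D ⟩ ≡ ⟨ c , e A ⟩ + ⟨ c , e A ⟩
  values = begin
    ⟨ c , e C ⟩ + ⟨ c , e D ⟩   ≡⟨ sym (⟨⟩-+ʳ c (e C) (e D)) ⟩
    ⟨ c , e C +ᵛ e D ⟩          ≡⟨ sym (⟨⟩-congʳ c sum≈) ⟩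
    ⟨ c , e A +ᵛ e B ⟩          ≡⟨ ⟨⟩-+ʳ c (e A) (e B) ⟩
    ⟨ c , e A ⟩ + ⟨ c , e B ⟩   ≡⟨ cong (⟨ c , e A ⟩ +_) (sym cA≡cB) ⟩
    ⟨ c , e A ⟩ + ⟨ c , e A ⟩   ∎
    where open ≡-Reasoning
  C-on-face : InFace M c (e C)
  C-on-face = vertex∈P M iC , λ y y∈P →
    subst (⟨ c , y ⟩ ≤_) (sym (tight-sumˡ (maximal _ (vertex∈P M iC)) (maximal _ (vertex∈P M iD)) values))
      (maximal y y∈P)
  partner : C ≡ A ⊎ C ≡ B → (C ≡ A × D ≡ B) ⊎ (C ≡ B × D ≡ A)
  partner (inj₁ refl) = inj₁ (refl , sym (+ᵛ-cancelˡ {p = A} sum≈))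
  partner (inj₂ refl) = inj₂ (refl , sym (+ᵛ-cancelˡ {p = B} (λ i → trans (+-comm (e B i) (e A i)) (sum≈ i))))

-- Matroid exchange

module _ {n} (M : Matroid n) where
  open Matroid M

  extend : ∀ {X Y} → Indep X → Indep Y → ∃[ Z ] (Indep Z × X ⊆ Z × Z ⊆ X ∪ Y × ∣ Y ∣ ℕ.≤ ∣ Z ∣)
  extend {X} {Y} iX iY = augment-within ∣ Y ∣ iX (ℕₚ.m≤m+n ∣ Y ∣ ∣ X ∣)
    where
    augment-within : ∀ k {X} → Indep X → ∣ Y ∣ ℕ.≤ k ℕ.+ ∣ X ∣ →
                     ∃[ Z ] (Indep Z × X ⊆ Z × Z ⊆ X ∪ Y × ∣ Y ∣ ℕ.≤ ∣ Z ∣)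
    augment-within k {X} iX bound with ∣ Y ∣ ℕ.≤? ∣ X ∣
    ... | yes ∣Y∣≤∣X∣ = X , iX , id , p⊆p∪q Y , ∣Y∣≤∣X∣
    augment-within zero    iX bound | no ∣Y∣≰∣X∣ = ⊥-elim (∣Y∣≰∣X∣ bound)
    augment-within (suc k) {X} iX bound | no ∣Y∣≰∣X∣ with augment iX iY (ℕₚ.≰⇒> ∣Y∣≰∣X∣)
    ... | b , b∈Y , b∉X , iX+b
      with augment-within k iX+b (subst (∣ Y ∣ ℕ.≤_) (trans (sym (ℕₚ.+-suc k ∣ X ∣))
                                                            (cong (k ℕ.+_) (sym (∣p∪⁅x⁆∣≡1+∣p∣ X b∉X)))) bound)
    ...   | Z , iZ , X+b⊆Z , Z⊆ , ∣Y∣≤∣Z∣ =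
      Z , iZ , X+b⊆Z ∘′ p⊆p∪q ⁅ b ⁆ , y∈q⇒p∪⁅y⁆∪q⊆p∪q X Y b∈Y ∘′ Z⊆ , ∣Y∣≤∣Z∣

  -- J collects the b ∈ B ∖ A with A - a + b independent, and K = B ∖ J.  If K + a is
  -- independent, extending it inside B + a makes some B - j + a with j ∈ J independent;
  -- otherwise extending K inside A produces an element of B ∖ A outside J that is exchangeable
  -- after all.  Since Indep is not decidable, J exists only under a double negation.
  module _ {A B : Subset n} {a : Fin n} (iA : Indep A) (iB : Indep B) (∣A∣≡∣B∣ : ∣ A ∣ ≡ ∣ B ∣)
           (a∈A : a ∈ A) (a∉B : a ∉ B)
           (no-exchange : ∀ b → b ∈ B → b ∉ A → Indep ((A ─ ⁅ a ⁆) ∪ ⁅ b ⁆) → Indep ((B ─ ⁅ b ⁆) ∪ ⁅ a ⁆) → ⊥)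
           (indep? : ∀ b → Dec (Indep ((A ─ ⁅ a ⁆) ∪ ⁅ b ⁆))) where

    A′ : Subset n
    A′ = A ─ ⁅ a ⁆

    exchangeable? : ∀ b → Dec (b ∈ B × b ∉ A × Indep (A′ ∪ ⁅ b ⁆))
    exchangeable? b = b ∈? B ×-dec (¬? (b ∈? A) ×-dec indep? b)

    J K : Subset n
    J = select exchangeable?
    K = B ─ J

    iA′ : Indep A′
    iA′ = indep-⊆ (p─q⊆p A ⁅ a ⁆) iA

    ∣A′∣<∣A∣ : ∣ A′ ∣ ℕ.< ∣ A ∣
    ∣A′∣<∣A∣ = ℕₚ.≤-reflexive (sym (∣p∣≡1+∣p─⁅x⁆∣ a∈A))

    ∉A′⇒∉A : ∀ {x} → x ≢ a → x ∉ A′ → x ∉ A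
    ∉A′⇒∉A x≢a x∉A′ x∈A = x∉A′ (x∈p∧x≢y⇒x∈p-y x∈A x≢a)

    ∣B─⁅j⁆∪⁅a⁆∣≡∣B∣ : ∀ {j} → j ∈ B → ∣ (B ─ ⁅ j ⁆) ∪ ⁅ a ⁆ ∣ ≡ ∣ B ∣
    ∣B─⁅j⁆∪⁅a⁆∣≡∣B∣ j∈B = trans (∣p∪⁅x⁆∣≡1+∣p∣ (B ─ ⁅ _ ⁆) (a∉B ∘′ p─q⊆p B ⁅ _ ⁆)) (sym (∣p∣≡1+∣p─⁅x⁆∣ j∈B))

    K+a-dependent : ¬ Indep (K ∪ ⁅ a ⁆) → ⊥
    K+a-dependent dep with extend (indep-⊆ (p─q⊆p B J) iB) iA
    ... | Z , iZ , K⊆Z , Z⊆K∪A , ∣A∣≤∣Z∣ with a ∈? Z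
    ...   | yes a∈Z = dep (indep-⊆ K+a⊆Z iZ)
      where
      K+a⊆Z : K ∪ ⁅ a ⁆ ⊆ Z
      K+a⊆Z x∈ with x∈p∪⁅y⁆⁻ K x∈
      ... | inj₁ x∈K = K⊆Z x∈K
      ... | inj₂ refl = a∈Z
    ...   | no a∉Z with augment iA′ iZ (ℕₚ.<-≤-trans ∣A′∣<∣A∣ ∣A∣≤∣Z∣)
    ...     | x , x∈Z , x∉A′ , iA′+x = Sum.[ x∉K , x∉A ] (x∈p∪q⁻ K A (Z⊆K∪A x∈Z))
      where
      x∉A : x ∉ A
      x∉A = ∉A′⇒∉A (λ { refl → a∉Z x∈Z }) x∉A′
      x∉K : x ∉ K
      x∉K x∈K = x∈p─q⇒x∉q B J x∈K (∈select⁺ exchangeable? (p─q⊆p B J x∈K , x∉A , iA′+x))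

    K+a-independent : Indep (K ∪ ⁅ a ⁆) → ⊥
    K+a-independent iK+a with extend iK+a iB
    ... | Z , iZ , K+a⊆Z , Z⊆K+a∪B , ∣B∣≤∣Z∣ with any? (λ j → j ∈? J ×-dec ¬? (j ∈? Z))
    ...   | yes (j , j∈J , j∉Z) =
      let j∈B , j∉A , iA′+j = ∈select⁻ exchangeable? j∈J
      in  no-exchange j j∈B j∉A iA′+j (indep-⊆ (W⊆Z j∈B) iZ)
      where
      B∩Z⊆W : ∀ {z} → z ∈ Z → z ∈ B → z ∈ (B ─ ⁅ j ⁆) ∪ ⁅ a ⁆
      B∩Z⊆W z∈Z z∈B = p⊆p∪q ⁅ a ⁆ (x∈p∧x≢y⇒x∈p-y z∈B (λ { refl → j∉Z z∈Z }))
      Z⊆W : Z ⊆ (B ─ ⁅ j ⁆) ∪ ⁅ a ⁆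
      Z⊆W z∈Z with x∈p∪q⁻ (K ∪ ⁅ a ⁆) B (Z⊆K+a∪B z∈Z)
      ... | inj₂ z∈B = B∩Z⊆W z∈Z z∈B
      ... | inj₁ z∈K+a with x∈p∪⁅y⁆⁻ K z∈K+a
      ...   | inj₁ z∈K  = B∩Z⊆W z∈Z (p─q⊆p B J z∈K)
      ...   | inj₂ refl = q⊆p∪q (B ─ ⁅ j ⁆) ⁅ a ⁆ (x∈⁅x⁆ a)
      W⊆Z : j ∈ B → (B ─ ⁅ j ⁆) ∪ ⁅ a ⁆ ⊆ Z
      W⊆Z j∈B = p⊆q∧∣q∣≤∣p∣⇒q⊆p Z⊆W (subst (ℕ._≤ ∣ Z ∣) (sym (∣B─⁅j⁆∪⁅a⁆∣≡∣B∣ j∈B)) ∣B∣≤∣Z∣)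
    ...   | no none with augment iA′ iB (subst (∣ A′ ∣ ℕ.<_) ∣A∣≡∣B∣ ∣A′∣<∣A∣)
    ...     | j , j∈B , j∉A′ , iA′+j = no-exchange j j∈B j∉A iA′+j (indep-⊆ W⊆Z iZ)
      where
      j∉A = ∉A′⇒∉A (λ { refl → a∉B j∈B }) j∉A′
      W⊆Z : (B ─ ⁅ j ⁆) ∪ ⁅ a ⁆ ⊆ Z
      W⊆Z w∈ with x∈p∪⁅y⁆⁻ (B ─ ⁅ j ⁆) w∈
      ... | inj₂ refl = K+a⊆Z (q⊆p∪q K ⁅ a ⁆ (x∈⁅x⁆ a))
      ... | inj₁ w∈B-j with _ ∈? J
      ...   | yes w∈J = decidable-stable (_ ∈? Z) (λ w∉Z → none (_ , w∈J , w∉Z))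
      ...   | no w∉J  = K+a⊆Z (p⊆p∪q ⁅ a ⁆ (x∈p∧x∉q⇒x∈p─q (p─q⊆p B ⁅ j ⁆ w∈B-j) w∉J))

  symmetric-exchange : ∀ {A B a} → Indep A → Indep B → ∣ A ∣ ≡ ∣ B ∣ → a ∈ A → a ∉ B →
    ¬ ¬ (∃[ b ] (b ∈ B × b ∉ A × Indep ((A ─ ⁅ a ⁆) ∪ ⁅ b ⁆) × Indep ((B ─ ⁅ b ⁆) ∪ ⁅ a ⁆)))
  symmetric-exchange {A} {B} {a} iA iB ∣A∣≡∣B∣ a∈A a∉B none =
    ¬¬-dec-∀ (λ b → Indep ((A ─ ⁅ a ⁆) ∪ ⁅ b ⁆)) λ indep? →
    ¬¬-excluded-middle λ where
      (yes iK+a) → K+a-independent iA iB ∣A∣≡∣B∣ a∈A a∉B no-exchange indep? iK+a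
      (no ¬iK+a) → K+a-dependent iA iB ∣A∣≡∣B∣ a∈A a∉B no-exchange indep? ¬iK+a
    where
    no-exchange : ∀ b → b ∈ B → b ∉ A → Indep ((A ─ ⁅ a ⁆) ∪ ⁅ b ⁆) → Indep ((B ─ ⁅ b ⁆) ∪ ⁅ a ⁆) → ⊥
    no-exchange b b∈B b∉A iA′+b iB′+a = none (b , b∈B , b∉A , iA′+b , iB′+a)

-- Pairs with a unique decomposition

module _ {n} (M : Matroid n) where
  open Matroid M

  unique-decomposition-sym : ∀ {A B} → UniqueDecomposition M A B → UniqueDecomposition M B A
  unique-decomposition-sym {A} {B} U C D iC iD sum≈ =
    Sum.swap (U C D iC iD (λ i → trans (+-comm (e A i) (e B i)) (sum≈ i)))

  adding-forced : ∀ {A B b} → UniqueDecomposition M A B → Indep B → b ∈ B → b ∉ A → Indep (A ∪ ⁅ b ⁆) →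
                  ∀ i → i ≢ b → lookup A i ≡ lookup B i
  adding-forced {A} {B} {b} U iB b∈B b∉A iA+b i i≢b
    with U (A ∪ ⁅ b ⁆) (B ─ ⁅ b ⁆) iA+b (indep-⊆ (p─q⊆p B ⁅ b ⁆) iB) (e-sum-adding b∈B b∉A)
  ... | inj₁ (A+b≡A , _) = ⊥-elim (b∉A (subst (b ∈_) A+b≡A (q⊆p∪q A ⁅ b ⁆ (x∈⁅x⁆ b))))
  ... | inj₂ (_ , B-b≡A) = trans (cong (λ X → lookup X i) (sym B-b≡A)) (lookup-─⁅y⁆-x B i≢b)

  swapping-forced : ∀ {A B a b} → UniqueDecomposition M A B → a ∈ A → a ∉ B → b ∈ B → b ∉ A →
                    Indep ((A ─ ⁅ a ⁆) ∪ ⁅ b ⁆) → Indep ((B ─ ⁅ b ⁆) ∪ ⁅ a ⁆) → (A ─ ⁅ a ⁆) ∪ ⁅ b ⁆ ≡ B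
  swapping-forced {A} {B} {a} {b} U a∈A a∉B b∈B b∉A iA′ iB′
    with U _ _ iA′ iB′ (e-sum-swapping a∈A a∉B b∈B b∉A)
  ... | inj₁ (A′≡A , _) = ⊥-elim (b∉A (subst (b ∈_) A′≡A (q⊆p∪q (A ─ ⁅ a ⁆) ⁅ b ⁆ (x∈⁅x⁆ b))))
  ... | inj₂ (A′≡B , _) = A′≡B

  data AdjacentPair (A B : Subset n) : Set where
    differ-in-one : ∀ b → (∀ i → i ≢ b → lookup A i ≡ lookup B i) → AdjacentPair A B
    differ-by-exchange : ∀ a b → a ∈ A → a ∉ B → b ∈ B → b ∉ A →
                         (∀ i → i ≢ a → i ≢ b → lookup A i ≡ lookup B i) → ¬ Indep (A ∪ ⁅ b ⁆) →
                         AdjacentPair A B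

  equal-size⇒adjacent : ∀ {A B} → Indep A → Indep B → A ≢ B → UniqueDecomposition M A B →
                        ∣ A ∣ ≡ ∣ B ∣ → AdjacentPair A B
  equal-size⇒adjacent {A} {B} iA iB A≢B U ∣A∣≡∣B∣
    with element-of-difference (ℕₚ.≤-reflexive (sym ∣A∣≡∣B∣)) A≢B
  ... | a , a∈A , a∉B
    with decidable-stable (any? (λ b → ¬? (b ∈? A) ×-dec ((A ─ ⁅ a ⁆) ∪ ⁅ b ⁆ ≟ₛ B)))
           (¬¬-map forced (symmetric-exchange M iA iB ∣A∣≡∣B∣ a∈A a∉B))
    where
    forced : _ → ∃[ b ] (b ∉ A × (A ─ ⁅ a ⁆) ∪ ⁅ b ⁆ ≡ B)
    forced (b , b∈B , b∉A , iA′ , iB′) = b , b∉A , swapping-forced U a∈A a∉B b∈B b∉A iA′ iB′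
  ... | b , b∉A , A′≡B = differ-by-exchange a b a∈A a∉B b∈B b∉A agree dependent
    where
    b∈B : b ∈ B
    b∈B = subst (b ∈_) A′≡B (q⊆p∪q (A ─ ⁅ a ⁆) ⁅ b ⁆ (x∈⁅x⁆ b))
    agree : ∀ i → i ≢ a → i ≢ b → lookup A i ≡ lookup B i
    agree i i≢a i≢b = trans (sym (swapped-lookup A i≢a i≢b)) (cong (λ X → lookup X i) A′≡B)
    dependent : ¬ Indep (A ∪ ⁅ b ⁆)
    dependent iA+b = a∉B (lookup⇒[]= a B
      (trans (sym (adding-forced U iB b∈B b∉A iA+b a (λ { refl → a∉B b∈B }))) ([]=⇒lookup a∈A)))

  unique-decomposition⇒adjacent : ∀ {A B} → Indep A → Indep B → A ≢ B → UniqueDecomposition M A B →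
                                  AdjacentPair A B
  unique-decomposition⇒adjacent {A} {B} iA iB A≢B U with ℕₚ.<-cmp ∣ A ∣ ∣ B ∣
  ... | tri≈ _ ∣A∣≡∣B∣ _ = equal-size⇒adjacent iA iB A≢B U ∣A∣≡∣B∣
  ... | tri< ∣A∣<∣B∣ _ _ with augment iA iB ∣A∣<∣B∣
  ...   | b , b∈B , b∉A , iA+b = differ-in-one b (adding-forced U iB b∈B b∉A iA+b)
  unique-decomposition⇒adjacent {A} {B} iA iB A≢B U | tri> _ _ ∣B∣<∣A∣ with augment iB iA ∣B∣<∣A∣
  ...   | a , a∈A , a∉B , iB+a =
    differ-in-one a (λ i i≢a → sym (adding-forced (unique-decomposition-sym U) iA a∈A a∉B iB+a i i≢a))

-- Exposing functionals

agreement-weight : Bool → Bool → ℚ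
agreement-weight true  true  = 2ℚ
agreement-weight false false = - 2ℚ
agreement-weight _     _     = 0ℚ

agreement-term : ∀ a b c → ((a ≡ b → c ≡ a) × agreement-weight a b * bit c ≡ agreement-weight a b * bit a)
                           ⊎ agreement-weight a b * bit c + 2ℚ ≤ agreement-weight a b * bit a
agreement-term true  true  true  = inj₁ ((λ _ → refl) , refl)
agreement-term true  true  false = inj₂ (from-yes (2ℚ * 0ℚ + 2ℚ ≤? 2ℚ * 1ℚ))
agreement-term true  false true  = inj₁ ((λ ()) , refl)
agreement-term true  false false = inj₁ ((λ ()) , refl)
agreement-term false true  true  = inj₁ ((λ ()) , refl)
agreement-term false true  false = inj₁ ((λ ()) , refl)
agreement-term false false true  = inj₂ (from-yes (- 2ℚ * 1ℚ + 2ℚ ≤? - 2ℚ * 0ℚ))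
agreement-term false false false = inj₁ ((λ _ → refl) , refl)

agreement-weight-sym : ∀ a b → agreement-weight a b * bit a ≡ agreement-weight a b * bit b
agreement-weight-sym true  true  = refl
agreement-weight-sym true  false = refl
agreement-weight-sym false true  = refl
agreement-weight-sym false false = refl

agreement : ∀ {n} → Subset n → Subset n → Vecℚ n
agreement A B i = agreement-weight (lookup A i) (lookup B i)

agreement-value-sym : ∀ {n} (A B : Subset n) → ⟨ agreement A B , e A ⟩ ≡ ⟨ agreement A B , e B ⟩
agreement-value-sym A B = Σᶠ-cong (λ i → agreement-weight-sym (lookup A i) (lookup B i))

agreement-bound : ∀ {n} (A B C : Subset n) →
  ((∀ i → lookup A i ≡ lookup B i → lookup C i ≡ lookup A i) × ⟨ agreement A B , e C ⟩ ≡ ⟨ agreement A B , e A ⟩)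
  ⊎ ⟨ agreement A B , e C ⟩ + 2ℚ ≤ ⟨ agreement A B , e A ⟩
agreement-bound A B C =
  Σᶠ-tight-or-gap 2ℚ (from-yes (0ℚ ≤? 2ℚ)) (λ i → agreement-term (lookup A i) (lookup B i) (lookup C i))

⟨+e⁅a⁆+e⁅b⁆,_⟩ : ∀ {n} {a b : Fin n} (w u : Vecℚ n) → ⟨ w +ᵛ (e ⁅ a ⁆ +ᵛ e ⁅ b ⁆) , u ⟩ ≡ ⟨ w , u ⟩ + (u a + u b)
⟨+e⁅a⁆+e⁅b⁆,_⟩ {a = a} {b} w u = trans (⟨⟩-+ˡ w _ u)
  (cong (⟨ w , u ⟩ +_) (trans (⟨⟩-+ˡ (e ⁅ a ⁆) (e ⁅ b ⁆) u) (cong₂ _+_ (⟨e⁅⁆,_⟩ a u) (⟨e⁅⁆,_⟩ b u))))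

agreeing-⊇-∪⁅b⁆ : ∀ {n} {A B C : Subset n} {a b} → b ∉ A → (∀ i → i ≢ a → i ≢ b → lookup A i ≡ lookup B i) →
                  (∀ i → lookup A i ≡ lookup B i → lookup C i ≡ lookup A i) →
                  lookup C a ≡ true → lookup C b ≡ true → A ∪ ⁅ b ⁆ ⊆ C
agreeing-⊇-∪⁅b⁆ {A = A} {C = C} {a} b∉A agree C≐A Ca Cb {x} x∈ with x∈p∪⁅y⁆⁻ A x∈
... | inj₂ refl = lookup⇒[]= x C Cb
... | inj₁ x∈A with x ≟ a
...   | yes refl = lookup⇒[]= x C Ca
...   | no x≢a   = lookup⇒[]= x C (trans (C≐A x (agree x x≢a (λ { refl → b∉A x∈A }))) ([]=⇒lookup x∈A))

module _ {n} (M : Matroid n) where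
  open Matroid M

  differ-in-one⇒edge : ∀ {A B b} → Indep A → Indep B → A ≢ B →
                       (∀ i → i ≢ b → lookup A i ≡ lookup B i) → IsEdge M A B
  differ-in-one⇒edge {A} {B} {b} iA iB A≢B agree =
    exposed-edge M (agreement A B) ⟨ agreement A B , e A ⟩ iA iB refl (sym (agreement-value-sym A B)) below
    where
    Ab≢Bb : lookup A b ≢ lookup B b
    Ab≢Bb Ab≡Bb = A≢B (lookup-ext-at b Ab≡Bb agree)
    below : ∀ C → Indep C → ⟨ agreement A B , e C ⟩ < ⟨ agreement A B , e A ⟩ ⊎ (C ≡ A ⊎ C ≡ B)
    below C _ with agreement-bound A B C
    ... | inj₂ gap = inj₁ (+2≤⇒< gap)
    ... | inj₁ (C≐A , _) with lookup C b Bool.≟ lookup A b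
    ...   | yes Cb≡Ab = inj₂ (inj₁ (lookup-ext-at b Cb≡Ab (λ i i≢b → C≐A i (agree i i≢b))))
    ...   | no Cb≢Ab  = inj₂ (inj₂ (lookup-ext-at b (other-bit Ab≢Bb Cb≢Ab)
                                     (λ i i≢b → trans (C≐A i (agree i i≢b)) (agree i i≢b))))

  differ-by-exchange⇒edge : ∀ {A B a b} → Indep A → Indep B → a ∈ A → a ∉ B → b ∈ B → b ∉ A →
                            (∀ i → i ≢ a → i ≢ b → lookup A i ≡ lookup B i) → ¬ Indep (A ∪ ⁅ b ⁆) →
                            IsEdge M A B
  differ-by-exchange⇒edge {A} {B} {a} {b} iA iB a∈A a∉B b∈B b∉A agree A+b-dependent =
    exposed-edge M c (V + 1ℚ) iA iB cA cB below
    where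
    w : Vecℚ n
    w = agreement A B
    V : ℚ
    V = ⟨ w , e A ⟩
    c : Vecℚ n
    c = w +ᵛ (e ⁅ a ⁆ +ᵛ e ⁅ b ⁆)
    value-bits : ∀ C {x y} → lookup C a ≡ x → lookup C b ≡ y → ⟨ c , e C ⟩ ≡ ⟨ w , e C ⟩ + (bit x + bit y)
    value-bits C refl refl = ⟨+e⁅a⁆+e⁅b⁆,_⟩ w (e C)
    cA : ⟨ c , e A ⟩ ≡ V + 1ℚ
    cA = trans (⟨+e⁅a⁆+e⁅b⁆,_⟩ w (e A)) (cong (V +_) (trans (cong₂ _+_ (e-∈ a∈A) (e-∉ b∉A)) (+-identityʳ 1ℚ)))
    cB : ⟨ c , e B ⟩ ≡ V + 1ℚ
    cB = trans (⟨+e⁅a⁆+e⁅b⁆,_⟩ w (e B)) (cong₂ _+_ (sym (agreement-value-sym A B))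
                                   (trans (cong₂ _+_ (e-∉ a∉B) (e-∈ b∈B)) (+-identityˡ 1ℚ)))
    V<V+1 : V < V + 1ℚ
    V<V+1 = subst (_< V + 1ℚ) (+-identityʳ V) (+-monoʳ-< V (from-yes (0ℚ <? 1ℚ)))
    below : ∀ C → Indep C → ⟨ c , e C ⟩ < V + 1ℚ ⊎ (C ≡ A ⊎ C ≡ B)
    below C iC with agreement-bound A B C | lookup C a in Ca | lookup C b in Cb
    ... | inj₂ gap | x | y = inj₁ (≤-<-trans (subst (_≤ V) (sym (value-bits C Ca Cb))
                                   (≤-trans (+-monoʳ-≤ ⟨ w , e C ⟩ (bit+bit≤2 x y)) gap)) V<V+1)
    ... | inj₁ (C≐A , _) | true | false = inj₂ (inj₁
      (lookup-ext-at₂ a b (trans Ca (sym ([]=⇒lookup a∈A))) (trans Cb (sym (∉⇒lookup≡false b∉A)))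
                         (λ i i≢a i≢b → C≐A i (agree i i≢a i≢b))))
    ... | inj₁ (C≐A , _) | false | true = inj₂ (inj₂
      (lookup-ext-at₂ a b (trans Ca (sym (∉⇒lookup≡false a∉B))) (trans Cb (sym ([]=⇒lookup b∈B)))
                         (λ i i≢a i≢b → trans (C≐A i (agree i i≢a i≢b)) (agree i i≢a i≢b))))
    ... | inj₁ (_ , U≡V) | false | false =
      inj₁ (subst (_< V + 1ℚ) (sym (trans (value-bits C Ca Cb) (trans (cong (_+ 0ℚ) U≡V) (+-identityʳ V)))) V<V+1)
    ... | inj₁ (C≐A , _) | true | true =
      ⊥-elim (A+b-dependent (indep-⊆ (agreeing-⊇-∪⁅b⁆ {B = B} b∉A agree C≐A Ca Cb) iC))

theorem6p2 : ∀ {n} (M : Matroid n) (A B : Subset n) →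
             Matroid.Indep M A → Matroid.Indep M B → A ≢ B →
             IsEdge M A B ⇔
             (∀ C D → Matroid.Indep M C → Matroid.Indep M D →
                (e A +ᵛ e B) ≈ᵛ (e C +ᵛ e D) →
                (C ≡ A × D ≡ B) ⊎ (C ≡ B × D ≡ A))
theorem6p2 M A B iA iB A≢B =
  mk⇔ (edge⇒unique-decomposition M iA iB A≢B) (λ U → adjacent⇒edge (unique-decomposition⇒adjacent M iA iB A≢B U))
  where
  adjacent⇒edge : AdjacentPair M A B → IsEdge M A B
  adjacent⇒edge (differ-in-one b agree) = differ-in-one⇒edge M iA iB A≢B agree
  adjacent⇒edge (differ-by-exchange a b a∈A a∉B b∈B b∉A agree dependent) =
    differ-by-exchange⇒edge M iA iB a∈A a∉B b∈B b∉A agree dependent
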